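{- Let $\mathcal{A}\subseteq\mathbb{N}$ and let $\mathcal{H}^*=\{h_1,h_2,\ldots\}$ be a set of integers. Suppose there is a partition $\mathcal{H}^*=B_1\cup B_2\cup\cdots$ into finite sets $B_i$ such that for every $M\geq1$ there exist infinitely many integers $n$ for which there are elements $h_{i,M}\in B_i$ ($1\le i\le M$) with $n+h_{i,M}\in\mathcal{A}$ for all $1\leq i\leq M$. Then there exist strictly increasing sequences of natural numbers $(a_j)_{j\geq1}$ and $(n_k)_{k\geq1}$ such that $h_{a_j}\in B_j$ for all $j$, and for every $k\geq1$ we have $n_k+h_{a_j}\in\mathcal{A}$ for all $1\leq j\leq k$.
   Formalization: The blocks are consecutive in the enumeration $h_1,h_2,\ldots$: for i < j, every position at which $h_1,h_2,\ldots$ meets $B_i$ precedes every position at which it meets $B_j$. The paper assumes this as well. -}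

module Defs where

open import Data.Nat using (ℕ; _≤_; _<_)
open import Data.Integer using (ℤ; +_; ∣_∣; _+_)
open import Data.List using (List)
open import Data.List.Membership.Propositional using (_∈_)
open import Data.Product using (Σ; _×_)
open import Relation.Binary.PropositionalEquality using (_≡_)

-- Indexing convention: everything is 0-based.  h_1, h_2, … of the paper
-- is  h 0, h 1, … ; blocks B_1, B_2, … are  B 0, B 1, … .

_∈ℕ_ : ℤ → (ℕ → Set) → Set
z ∈ℕ 𝒜 = Σ ℕ λ m → (+ m ≡ z) × 𝒜 m

IsPartition : (h : ℕ → ℤ) (B : ℕ → List ℤ) → Set
IsPartition h B =
  (∀ i x → x ∈ B i → Σ ℕ λ m → h m ≡ x)
  × (∀ m → Σ ℕ λ i → h m ∈ B i)
  × (∀ i j x → x ∈ B i → x ∈ B j → i ≡ j)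

-- The blocks are consecutive in the enumeration h (needed for the
-- conclusion "a_j strictly increasing" to make sense).
OrderedBlocks : (h : ℕ → ℤ) (B : ℕ → List ℤ) → Set
OrderedBlocks h B = ∀ i i′ m m′ → i < i′ → h m ∈ B i → h m′ ∈ B i′ → m < m′

StrictlyIncreasing : (ℕ → ℕ) → Set
StrictlyIncreasing f = ∀ j → f j < f (Data.Nat.suc j)

-- Hypothesis: for every M there are infinitely many integers n (i.e. with
-- unbounded absolute value) such that every block B_i, i < M, contains an
-- element x with n + x ∈ 𝒜.
Hypothesis : (𝒜 : ℕ → Set) (B : ℕ → List ℤ) → Set
Hypothesis 𝒜 B =
  ∀ (M : ℕ) → 1 ≤ M → ∀ (N : ℕ) → Σ ℤ λ n → N ≤ ∣ n ∣ ×
    (∀ i → i < M → Σ ℤ λ x → x ∈ B i × (n + x) ∈ℕ 𝒜)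

Conclusion : (𝒜 : ℕ → Set) (h : ℕ → ℤ) (B : ℕ → List ℤ) → Set
Conclusion 𝒜 h B =
  Σ (ℕ → ℕ) λ a → Σ (ℕ → ℕ) λ n →
    StrictlyIncreasing a × StrictlyIncreasing n
    × (∀ j → h (a j) ∈ B j)
    × (∀ k j → j ≤ k → (+ n k + h (a j)) ∈ℕ 𝒜)

{-# OPTIONS --safe #-}
module Submission where

-- Call a choice of elements x_0 ∈ B_0, …, x_{k-1} ∈ B_{k-1} admissible if, for
-- every M, infinitely many n admit elements y_i ∈ B_i (i < M) with n + y_i ∈ 𝒜
-- and y_i = x_i for all i < k.  The hypothesis says that the empty choice is
-- admissible.  An admissible choice extends to an admissible choice of x_k ∈ B_k:
-- otherwise each of the finitely many candidates in B_k fails beyond some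
-- threshold, and beyond the largest threshold no candidate would remain.
-- Iterating yields an infinite sequence all of whose prefixes are admissible;
-- admissibility of the first k + 1 terms then supplies arbitrarily large n_k,
-- and the indices a_j increase because the blocks are ordered.

open import Defs
open import Data.Nat using (ℕ)
open import Data.Integer using (ℤ)
open import Data.List using (List)
open import Level using (0ℓ)
open import Axiom.ExcludedMiddle using (ExcludedMiddle)

open import Axiom.DoubleNegationElimination using (em⇒dne)
open import Data.Empty using (⊥-elim)
open import Data.Integer using (+_; -[1+_]; ∣_∣; _+_; sign)
open import Data.Integer.Properties using (sign-⊖-<)
open import Data.List using (_∷_; [])
open import Data.List.Membership.Propositional using (_∈_; find; lose)
open import Data.List.Relation.Unary.Any as Any using (Any; here; there)
open import Data.List.Relation.Unary.Any.Properties using (¬Any[])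
open import Data.Nat using (suc; zero; _≤_; _<_; _⊔_; _≟_; z≤n; s≤s; s≤s⁻¹; z<s)
open import Data.Nat.Properties
  using (≤-trans; <-≤-trans; ≤∧≢⇒<; n<1+n; m≤m⊔n; m≤n⊔m; m≤n⇒m≤o⊔n; m≤n⇒m≤1+n;
         m<1+n⇒m<n∨m≡n; <⇒≢)
open import Data.Product using (Σ; ∃-syntax; _×_; _,_; proj₁; proj₂)
open import Data.Sum using (inj₁; inj₂)
open import Function using (case_of_)
open import Relation.Nullary using (¬_; yes; no)
open import Relation.Binary.PropositionalEquality using (_≡_; _≢_; refl; sym; trans; cong; subst)

∀Any⇒Any∀ : ExcludedMiddle 0ℓ → {A : Set} {P : A → ℕ → Set}
  → (∀ {y l l′} → l ≤ l′ → P y l′ → P y l)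
  → ∀ ys → (∀ l → Any (λ y → P y l) ys) → Any (λ y → ∀ l → P y l) ys
∀Any⇒Any∀ em antitone [] often = ⊥-elim (¬Any[] (often 0))
∀Any⇒Any∀ em {P = P} antitone (y ∷ ys) often with em {∃[ l ] ¬ P y l}
... | no never-fails = here (λ l → em⇒dne em (λ ¬Pyl → never-fails (l , ¬Pyl)))
... | yes (l₀ , ¬Pyl₀) = there (∀Any⇒Any∀ em antitone ys λ l → avoid-y l (often (l₀ ⊔ l)))
  where
  avoid-y : ∀ l → Any (λ z → P z (l₀ ⊔ l)) (y ∷ ys) → Any (λ z → P z l) ys
  avoid-y l (here Py) = ⊥-elim (¬Pyl₀ (antitone (m≤m⊔n l₀ l) Py))
  avoid-y l (there Pys) = Any.map (antitone (m≤n⊔m l₀ l)) Pys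

_[_≔_] : {A : Set} → (ℕ → A) → ℕ → A → ℕ → A
(x [ k ≔ y ]) i with i ≟ k
... | yes _ = y
... | no _ = x i

[≔]-same : {A : Set} (x : ℕ → A) (k : ℕ) (y : A) → (x [ k ≔ y ]) k ≡ y
[≔]-same x k y with k ≟ k
... | yes _ = refl
... | no k≢k = ⊥-elim (k≢k refl)

[≔]-other : {A : Set} (x : ℕ → A) {k i : ℕ} (y : A) → i ≢ k → (x [ k ≔ y ]) i ≡ x i
[≔]-other x {k} {i} y i≢k with i ≟ k
... | yes i≡k = ⊥-elim (i≢k i≡k)
... | no _ = refl

extend-forever : {A : Set} (S : ℕ → A → Set) (Good : ℕ → (ℕ → A) → Set)
  → (∀ {k x x′} → (∀ i → i < k → x i ≡ x′ i) → Good k x → Good k x′)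
  → (∀ {k x} → Good k x → Σ A λ y → S k y × Good (suc k) (x [ k ≔ y ]))
  → ∀ {x₀} → Good 0 x₀
  → Σ (ℕ → _) λ X → (∀ k → S k (X k)) × (∀ k → Good k X)
extend-forever {A} S Good respects extend {x₀} good₀ =
  X , (λ k → proj₁ (proj₂ (extend (proj₂ (prefix k)))))
    , (λ k → respects (prefix-agrees k) (proj₂ (prefix k)))
  where
  prefix : ∀ k → Σ (ℕ → A) (Good k)
  prefix zero = x₀ , good₀
  prefix (suc k) = let y , _ , good = extend (proj₂ (prefix k)) in proj₁ (prefix k) [ k ≔ y ] , good

  X : ℕ → A
  X k = proj₁ (extend (proj₂ (prefix k)))

  prefix-agrees : ∀ k i → i < k → proj₁ (prefix k) i ≡ X i
  prefix-agrees (suc k) i i<1+k with m<1+n⇒m<n∨m≡n i<1+k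
  ... | inj₂ refl = [≔]-same _ k (X k)
  ... | inj₁ i<k = trans ([≔]-other _ (X k) (<⇒≢ i<k)) (prefix-agrees k i i<k)

+m≡i+j⇒∣j∣<∣i∣⇒i≡+∣i∣ : ∀ {m i j} → + m ≡ i + j → ∣ j ∣ < ∣ i ∣ → i ≡ + ∣ i ∣
+m≡i+j⇒∣j∣<∣i∣⇒i≡+∣i∣ {i = + _} _ _ = refl
+m≡i+j⇒∣j∣<∣i∣⇒i≡+∣i∣ {i = -[1+ _ ]} {j = + _} m≡i+j ∣j∣<∣i∣
  with () ← trans (cong sign m≡i+j) (sign-⊖-< ∣j∣<∣i∣)
+m≡i+j⇒∣j∣<∣i∣⇒i≡+∣i∣ {i = -[1+ _ ]} {j = -[1+ _ ]} () _

increasing-choice : {P : ℕ → ℕ → Set} → (∀ k p → Σ ℕ λ m → p < m × P k m)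
  → Σ (ℕ → ℕ) λ n → StrictlyIncreasing n × (∀ k → P k (n k))
increasing-choice {P} pick = n , (λ k → proj₁ (proj₂ (pick (suc k) (n k)))) , P-n
  where
  n : ℕ → ℕ
  n zero = proj₁ (pick 0 0)
  n (suc k) = proj₁ (pick (suc k) (n k))

  P-n : ∀ k → P k (n k)
  P-n zero = proj₂ (proj₂ (pick 0 0))
  P-n (suc k) = proj₂ (proj₂ (pick (suc k) (n k)))

module _ (𝒜 : ℕ → Set) (B : ℕ → List ℤ) where

  Row : ℕ → (ℕ → ℤ) → ℤ → ℕ → Set
  Row k x n i = Σ ℤ λ y → y ∈ B i × (i < k → y ≡ x i) × (n + y) ∈ℕ 𝒜

  -- A single bound l serves both as the number M of rows and as the lower
  -- bound on ∣ n ∣, so that witnessing is antitone in one parameter.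
  Witnessed : ℕ → (ℕ → ℤ) → ℕ → Set
  Witnessed k x l = Σ ℤ λ n → l ≤ ∣ n ∣ × (∀ i → i < l → Row k x n i)

  Admissible : ℕ → (ℕ → ℤ) → Set
  Admissible k x = ∀ l → Witnessed k x l

  witnessed-antitone : ∀ {k x l l′} → l ≤ l′ → Witnessed k x l′ → Witnessed k x l
  witnessed-antitone l≤l′ (n , l′≤∣n∣ , rows) =
    n , ≤-trans l≤l′ l′≤∣n∣ , λ i i<l → rows i (<-≤-trans i<l l≤l′)

  admissible-respects : ∀ {k x x′} → (∀ i → i < k → x i ≡ x′ i)
    → Admissible k x → Admissible k x′
  admissible-respects x≗x′ adm l with adm l
  ... | n , l≤∣n∣ , rows = n , l≤∣n∣ , λ i i<l →
    let y , y∈B , forced , y∈𝒜 = rows i i<l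
    in y , y∈B , (λ i<k → trans (forced i<k) (x≗x′ i i<k)) , y∈𝒜

  admissible₀ : Hypothesis 𝒜 B → ∀ {x} → Admissible 0 x
  admissible₀ hyp l with hyp (suc l) (s≤s z≤n) l
  ... | n , l≤∣n∣ , rows = n , l≤∣n∣ , λ i i<l →
    let y , y∈B , y∈𝒜 = rows i (m≤n⇒m≤1+n i<l)
    in y , y∈B , (λ ()) , y∈𝒜

  admissible-extends-witnessed : ∀ {k x} → Admissible k x
    → ∀ l → Any (λ y → Witnessed (suc k) (x [ k ≔ y ]) l) (B k)
  admissible-extends-witnessed {k} {x} adm l with adm (suc k ⊔ l)
  ... | n , bound , rows with rows k (m≤m⊔n (suc k) l)
  ... | y , y∈B , _ , y∈𝒜 = lose y∈B (n , ≤-trans (m≤n⊔m (suc k) l) bound , rows′)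
    where
    rows′ : ∀ i → i < l → Row (suc k) (x [ k ≔ y ]) n i
    rows′ i i<l = case i ≟ k of λ where
      (yes refl) → y , y∈B , (λ _ → sym ([≔]-same x k y)) , y∈𝒜
      (no i≢k) →
        let z , z∈B , forced , z∈𝒜 = rows i (<-≤-trans i<l (m≤n⊔m (suc k) l))
        in z , z∈B , (λ i<1+k → trans (forced (≤∧≢⇒< (s≤s⁻¹ i<1+k) i≢k)) (sym ([≔]-other x y i≢k))) , z∈𝒜

  admissible-extend : ExcludedMiddle 0ℓ → ∀ {k x} → Admissible k x
    → Σ ℤ λ y → y ∈ B k × Admissible (suc k) (x [ k ≔ y ])
  admissible-extend em {k} adm =
    find (∀Any⇒Any∀ em witnessed-antitone (B k) (admissible-extends-witnessed adm))

  admissible-witness : ∀ {k x} → Admissible (suc k) x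
    → ∀ p → Σ ℕ λ m → p < m × (∀ j → j ≤ k → (+ m + x j) ∈ℕ 𝒜)
  admissible-witness {k} {x} adm p with adm (suc (k ⊔ (p ⊔ ∣ x 0 ∣)))
  ... | n , bound , rows =
    ∣ n ∣ , ≤-trans (s≤s (m≤n⇒m≤o⊔n k (m≤m⊔n p _))) bound
          , λ j j≤k → subst (λ i → (i + x j) ∈ℕ 𝒜) n≡+∣n∣ (forced-row j (s≤s j≤k))
    where
    forced-row : ∀ j → j < suc k → (n + x j) ∈ℕ 𝒜
    forced-row j j<1+k =
      let y , _ , forced , y∈𝒜 = rows j (≤-trans j<1+k (s≤s (m≤m⊔n k _)))
      in subst (λ z → (n + z) ∈ℕ 𝒜) (forced j<1+k) y∈𝒜

    n≡+∣n∣ : n ≡ + ∣ n ∣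
    n≡+∣n∣ = +m≡i+j⇒∣j∣<∣i∣⇒i≡+∣i∣ (proj₁ (proj₂ (forced-row 0 z<s)))
               (≤-trans (s≤s (m≤n⇒m≤o⊔n k (m≤n⊔m p _))) bound)

proposition5p1 : ExcludedMiddle 0ℓ → (𝒜 : ℕ → Set) (h : ℕ → ℤ) (B : ℕ → List ℤ)
    → IsPartition h B → OrderedBlocks h B → Hypothesis 𝒜 B → Conclusion 𝒜 h B
proposition5p1 em 𝒜 h B (B⊆ℋ , _) ordered hyp
  with extend-forever (λ k y → y ∈ B k) (Admissible 𝒜 B) (admissible-respects 𝒜 B)
         (admissible-extend 𝒜 B em) (admissible₀ 𝒜 B hyp {λ _ → + 0})
... | X , X∈B , X-admissible
  with increasing-choice (λ k → admissible-witness 𝒜 B (X-admissible (suc k)))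
... | n , n-increasing , n-good =
  a , n , a-increasing , n-increasing , ha∈B
    , λ k j j≤k → subst (λ z → (+ n k + z) ∈ℕ 𝒜) (sym (ha≡X j)) (n-good k j j≤k)
  where
  a : ℕ → ℕ
  a j = proj₁ (B⊆ℋ j (X j) (X∈B j))

  ha≡X : ∀ j → h (a j) ≡ X j
  ha≡X j = proj₂ (B⊆ℋ j (X j) (X∈B j))

  ha∈B : ∀ j → h (a j) ∈ B j
  ha∈B j = subst (_∈ B j) (sym (ha≡X j)) (X∈B j)

  a-increasing : StrictlyIncreasing a
  a-increasing j = ordered j (suc j) (a j) (a (suc j)) (n<1+n j) (ha∈B j) (ha∈B (suc j))
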